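{- Let $\mathbb{P}_{\mathfrak{p}}=\langle\{\phi\},\chi,\mathsf{H},\mathbb{E},\mathfrak{p}\rangle$ be a probabilistic abduction problem, $\mathbf{V}$ the set of variables occurring in $\mathbb{P}_{\mathfrak{p}}$, and $\tau$ an $\mathcal{L}_{\mathsf{CPL}}$-term built from literals in $\mathsf{H}$. Then $\tau$ is a solution to $\mathbb{P}_{\mathfrak{p}}$ if and only if both of the following hold: (1) $\mu(\|\phi\wedge\tau\|_{\mathfrak{M}})\le\mu(\|\chi\|_{\mathfrak{M}})$ in every probabilistic model $\mathfrak{M}=\langle 2^{\mathbf{V}},\mu\rangle$; (2) there is a probabilistic model $\mathfrak{M}'=\langle 2^{\mathbf{V}},\mu'\rangle$ such that $\mu'$ is coherent with $\mathfrak{p}$ and $\mathfrak{Pr}_{\mu'}(\chi\mid\phi\wedge\tau)$ is defined and equals $1$.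
   Context: $\mathcal{L}_{\mathsf{CPL}}$ is the set of classical propositional formulas over a countable set of variables, built with $\neg,\wedge,\vee$ (other classical connectives as abbreviations), with classical entailment $\models_{\mathsf{CPL}}$; an $\mathcal{L}_{\mathsf{CPL}}$-term is a conjunction of literals. A probabilistic model for a finite set of variables $\mathbf{V}$ is $\mathfrak{M}=\langle 2^{\mathbf{V}},\mu\rangle$ with $\mu$ a probability measure on the power set of $2^{\mathbf{V}}$; truth sets: $\|p\|_{\mathfrak{M}}=\{X\subseteq\mathbf{V}:p\in X\}$, $\|\neg\phi\|$ complement in $2^{\mathbf{V}}$, $\|\phi\wedge\psi\|$ intersection, $\|\phi\vee\psi\|$ union. A probabilistic abduction problem (PrAP) is $\mathbb{P}_{\mathfrak{p}}=\langle\Phi,\chi,\mathsf{H},\mathbb{E},\mathfrak{p}\rangle$ where $\Phi\cup\{\chi\}\cup\mathbb{E}\subseteq\mathcal{L}_{\mathsf{CPL}}$ is finite, the variables of $\mathbb{E}$ occur in $\Phi\cup\{\chi\}$, $\mathsf{H}$ is a finite set of literals whose variables occur in $\Phi\cup\{\chi\}$, and $\mathfrak{p}:\mathbb{E}\to[0,1]\cap\mathbb{Q}$. For $\mathbf{V}$ the variables of $\mathbb{P}_{\mathfrak{p}}$, $\mu$ is coherent with $\mathfrak{p}$ iff $\mu(\|\psi\|)=\mathfrak{p}(\psi)$ for all $\psi\in\mathbb{E}$. For $\Phi=\{\phi\}$, a solution to $\mathbb{P}_{\mathfrak{p}}$ is an $\mathcal{L}_{\mathsf{CPL}}$-term $\tau$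 built from literals in $\mathsf{H}$ such that $\phi,\tau\models_{\mathsf{CPL}}\chi$ and there is a probabilistic model $\mathfrak{M}=\langle 2^{\mathbf{V}},\mu\rangle$ with $\mu$ coherent with $\mathfrak{p}$ and $\mu(\|\phi\wedge\tau\|_{\mathfrak{M}})>0$. For $\mu(\|\psi\|)>0$, the conditional probability is $\mathfrak{Pr}_\mu(\phi'\mid\psi)=\mu(\|\phi'\wedge\psi\|)/\mu(\|\psi\|)$ (undefined otherwise).
   Formalization: The probability measure μ of every probabilistic model ⟨2^V, μ⟩ takes values in ℚ, being given by rational point masses on the worlds. -}

module Defs where

open import Data.Bool using (Bool; true; false; _∧_; _∨_; not; T)
open import Data.Nat using (ℕ; _≡ᵇ_)
import Data.Nat as ℕ
open import Data.List using (List; []; _∷_; _++_; map; concatMap; filterᵇ; foldr; deduplicate)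
open import Data.Bool.ListAction using (any)
open import Data.List.NonEmpty using (List⁺; toList)
open import Data.List.Membership.Propositional using (_∈_)
open import Data.List.Relation.Unary.All using (All)
open import Data.Product using (Σ; _×_; ∃; ∃-syntax)
open import Data.Rational using (ℚ; 0ℚ; 1ℚ; _+_; _*_; _≤_; _<_; 1/_; positive)
open import Data.Rational.Properties using (pos⇒nonZero)
open import Relation.Binary.PropositionalEquality using (_≡_)

data Formula : Set where
  var  : ℕ → Formula
  ¬ᶠ_  : Formula → Formula
  _∧ᶠ_ : Formula → Formula → Formula
  _∨ᶠ_ : Formula → Formula → Formula

data Literal : Set where
  pos : ℕ → Literal
  neg : ℕ → Literal

-- An L_CPL-term: a (non-empty) conjunction of literals
Term : Set
Term = List⁺ Literal

vars : Formula → List ℕ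
vars (var p)   = p ∷ []
vars (¬ᶠ φ)    = vars φ
vars (φ ∧ᶠ ψ)  = vars φ ++ vars ψ
vars (φ ∨ᶠ ψ)  = vars φ ++ vars ψ

litVar : Literal → ℕ
litVar (pos p) = p
litVar (neg p) = p

eval : (ℕ → Bool) → Formula → Bool
eval v (var p)  = v p
eval v (¬ᶠ φ)   = not (eval v φ)
eval v (φ ∧ᶠ ψ) = eval v φ ∧ eval v ψ
eval v (φ ∨ᶠ ψ) = eval v φ ∨ eval v ψ

evalLit : (ℕ → Bool) → Literal → Bool
evalLit v (pos p) = v p
evalLit v (neg p) = not (v p)

evalLits : (ℕ → Bool) → List Literal → Bool
evalLits v []       = true
evalLits v (l ∷ ls) = evalLit v l ∧ evalLits v ls

evalTerm : (ℕ → Bool) → Term → Bool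
evalTerm v τ = evalLits v (toList τ)

Entails : Formula → Term → Formula → Set
Entails φ τ χ = ∀ (v : ℕ → Bool) → T (eval v φ ∧ evalTerm v τ) → T (eval v χ)

-- Possible worlds: subsets X ⊆ V (as lists), and the space 2^V

subsets : List ℕ → List (List ℕ)
subsets []       = [] ∷ []
subsets (x ∷ xs) = map (x ∷_) (subsets xs) ++ subsets xs

worldVal : List ℕ → ℕ → Bool
worldVal X p = any (p ≡ᵇ_) X

⟦_⟧ : Formula → List ℕ → Bool
⟦ φ ⟧ X = eval (worldVal X) φ

⟦_∧_⟧ᵗ : Formula → Term → List ℕ → Bool
⟦ φ ∧ τ ⟧ᵗ X = eval (worldVal X) φ ∧ evalTerm (worldVal X) τ

sumℚ : List ℚ → ℚ
sumℚ = foldr _+_ 0ℚ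

-- Probabilistic models  ⟨ 2^V , μ ⟩ : a probability measure on the
-- (finite) power set of 2^V, given by its point masses on the worlds.

record ProbModel (V : List ℕ) : Set where
  field
    mass    : List ℕ → ℚ
    nonneg  : ∀ X → X ∈ subsets V → 0ℚ ≤ mass X
    total   : sumℚ (map mass (subsets V)) ≡ 1ℚ
open ProbModel public

μ : {V : List ℕ} → ProbModel V → (List ℕ → Bool) → ℚ
μ {V} M A = sumℚ (map (mass M) (filterᵇ A (subsets V)))

condPr : {V : List ℕ} (M : ProbModel V) (a b : List ℕ → Bool) →
         0ℚ < μ M b → ℚ
condPr M a b h =
  μ M (λ X → a X ∧ b X) * (1/ μ M b) {{pos⇒nonZero (μ M b) {{positive h}}}}

CondPrIs : {V : List ℕ} (M : ProbModel V) (a b : List ℕ → Bool) → ℚ → Set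
CondPrIs M a b q = Σ (0ℚ < μ M b) (λ h → condPr M a b h ≡ q)

-- Probabilistic abduction problems with Φ = {φ}

_⊆ˡ_ : List ℕ → List ℕ → Set
xs ⊆ˡ ys = All (_∈ ys) xs

record PrAP : Set where
  field
    φ  : Formula
    χ  : Formula
    H  : List Literal
    E  : List Formula
    𝔭  : Formula → ℚ     -- only its values on E matter
    E-vars : concatMap vars E ⊆ˡ (vars φ ++ vars χ)
    H-vars : map litVar H ⊆ˡ (vars φ ++ vars χ)
    𝔭-range : All (λ ψ → (0ℚ ≤ 𝔭 ψ) × (𝔭 ψ ≤ 1ℚ)) E
open PrAP public

Vars : PrAP → List ℕ
Vars P = deduplicate ℕ._≟_ (vars (φ P) ++ vars (χ P))

Coherent : (P : PrAP) → ProbModel (Vars P) → Set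
Coherent P M = All (λ ψ → μ M ⟦ ψ ⟧ ≡ 𝔭 P ψ) (E P)

BuiltFromH : PrAP → Term → Set
BuiltFromH P τ = All (_∈ H P) (toList τ)

IsSolution : PrAP → Term → Set
IsSolution P τ =
  BuiltFromH P τ ×
  Entails (φ P) τ (χ P) ×
  (∃[ M ] (Coherent P M × (0ℚ < μ M ⟦ φ P ∧ τ ⟧ᵗ)))

-- Entailment φ, τ ⊨ χ says exactly that ‖φ ∧ τ‖ ⊆ ‖χ‖ in 2^V. Monotonicity of μ
-- then gives (1), and in any coherent model giving φ ∧ τ positive mass it gives
-- Pr(χ | φ ∧ τ) = 1. Conversely, a valuation v refuting the entailment is
-- mirrored by the world X = {p ∈ V | v p}, and the point mass at X violates (1);
-- the positivity demanded of a solution is supplied by the coherent model of (2).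
module Submission where

open import Defs
open import Data.Product using (_×_; ∃-syntax)
open import Data.Rational using (_≤_; 1ℚ)
open import Data.Bool using (_∧_)
open import Function.Bundles using (_⇔_)

open import Data.Bool using (Bool; true; false; not; _∨_; if_then_else_; T; T?)
open import Data.Bool.Properties using (T-≡; T-∧; ⇔→≡)
open import Data.Empty using (⊥-elim)
open import Data.List using (List; []; _∷_; _++_; map; filterᵇ)
open import Data.List.NonEmpty using (toList)
open import Data.List.Properties using (≡-dec; ∷-injectiveʳ)
open import Data.List.Membership.Propositional using (_∈_; _∉_)
open import Data.List.Membership.Propositional.Properties
  using (∈-map⁺; ∈-map⁻; ∈-++⁺ˡ; ∈-++⁺ʳ; ∈-++⁻; ∈-filter⁺; ∈-filter⁻; ∈-deduplicate⁺)
open import Data.List.Relation.Binary.Subset.Propositional using (_⊆_)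
open import Data.List.Relation.Binary.Subset.Propositional.Properties using (∷⁺ʳ)
open import Data.List.Relation.Unary.All as All using (All)
open import Data.List.Relation.Unary.All.Properties using (All¬⇒¬Any)
open import Data.List.Relation.Unary.Any as Any using (here; there)
open import Data.List.Relation.Unary.Any.Properties using (any⁺; any⁻)
open import Data.List.Relation.Unary.AllPairs using ([]; _∷_)
open import Data.List.Relation.Unary.Unique.Propositional using (Unique)
import Data.List.Relation.Unary.Unique.Propositional.Properties as Unique
open import Data.Nat using (ℕ)
import Data.Nat as ℕ
open import Data.List.Relation.Unary.Unique.DecPropositional.Properties ℕ._≟_
  using (deduplicate-!)
open import Data.Nat.Properties using (≡ᵇ⇒≡; ≡⇒≡ᵇ)
open import Data.Product using (_,_; proj₂)
open import Data.Rational using (ℚ; 0ℚ; _+_; _*_; _<_; 1/_; NonZero; positive)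
open import Data.Rational.Properties
  using (+-identityˡ; +-identityʳ; +-mono-≤; +-monoʳ-≤; ≤-refl; ≤-antisym;
         nonNegative⁻¹; 1≢0; *-inverseʳ; pos⇒nonZero)
open import Data.Sum using (inj₁; inj₂)
open import Function using (_∘_)
open import Function.Bundles using (mk⇔; Equivalence)
open import Relation.Binary.Definitions using (DecidableEquality)
open import Relation.Binary.PropositionalEquality
  using (_≡_; refl; sym; trans; cong; cong₂; subst; subst₂; module ≡-Reasoning)
open import Relation.Nullary using (¬_; yes; no; does)

open Equivalence using (to; from)

0≤1 : 0ℚ ≤ 1ℚ
0≤1 = nonNegative⁻¹ 1ℚ

1≰0 : ¬ (1ℚ ≤ 0ℚ)
1≰0 1≤0 = 1≢0 (≤-antisym 1≤0 0≤1)

p≤q⇒p≤r+q : ∀ {p q r} → 0ℚ ≤ r → p ≤ q → p ≤ r + q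
p≤q⇒p≤r+q {p} 0≤r p≤q = subst (_≤ _) (+-identityˡ p) (+-mono-≤ 0≤r p≤q)

sumℚ-filterᵇ-mono : ∀ {A : Set} (f : A → ℚ) (a b : A → Bool) xs →
  (∀ x → x ∈ xs → 0ℚ ≤ f x) → (∀ x → T (a x) → T (b x)) →
  sumℚ (map f (filterᵇ a xs)) ≤ sumℚ (map f (filterᵇ b xs))
sumℚ-filterᵇ-mono f a b [] _ _ = ≤-refl
sumℚ-filterᵇ-mono f a b (x ∷ xs) f≥0 a⇒b
  with a x in ax | b x in bx | sumℚ-filterᵇ-mono f a b xs (λ y → f≥0 y ∘ there) a⇒b
... | true  | true  | ih = +-monoʳ-≤ (f x) ih
... | true  | false | _  = ⊥-elim (subst T bx (a⇒b x (subst T (sym ax) _)))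
... | false | true  | ih = p≤q⇒p≤r+q (f≥0 x (here refl)) ih
... | false | false | ih = ih

module _ {A : Set} (_≟_ : DecidableEquality A) where

  pointMass : A → A → ℚ
  pointMass x y = if does (y ≟ x) then 1ℚ else 0ℚ

  pointMass-nonNeg : ∀ x y → 0ℚ ≤ pointMass x y
  pointMass-nonNeg x y with y ≟ x
  ... | yes _ = 0≤1
  ... | no  _ = ≤-refl

  sumℚ-pointMass-∉ : ∀ {x} xs → x ∉ xs → sumℚ (map (pointMass x) xs) ≡ 0ℚ
  sumℚ-pointMass-∉ [] _ = refl
  sumℚ-pointMass-∉ {x} (y ∷ ys) x∉ with y ≟ x
  ... | yes refl = ⊥-elim (x∉ (here refl))
  ... | no  _    = trans (+-identityˡ _) (sumℚ-pointMass-∉ ys (x∉ ∘ there))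

  sumℚ-pointMass-∈ : ∀ {x xs} → Unique xs → x ∈ xs → sumℚ (map (pointMass x) xs) ≡ 1ℚ
  sumℚ-pointMass-∈ {x} {y ∷ ys} (y∉ys ∷ ys!) x∈ with y ≟ x
  ... | yes refl = trans (cong (1ℚ +_) (sumℚ-pointMass-∉ ys (All¬⇒¬Any y∉ys))) (+-identityʳ 1ℚ)
  ... | no  y≢x  = trans (+-identityˡ _) (sumℚ-pointMass-∈ ys! (Any.tail (y≢x ∘ sym) x∈))

subsets-⊆ : ∀ V {Y} → Y ∈ subsets V → Y ⊆ V
subsets-⊆ [] (here refl) ()
subsets-⊆ (x ∷ xs) Y∈ with ∈-++⁻ (map (x ∷_) (subsets xs)) Y∈
... | inj₂ Y∈′ = there ∘ subsets-⊆ xs Y∈′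
... | inj₁ Y∈′ with ∈-map⁻ (x ∷_) Y∈′
...   | _ , Z∈ , refl = ∷⁺ʳ x (subsets-⊆ xs Z∈)

subsets-unique : ∀ {V} → Unique V → Unique (subsets V)
subsets-unique {[]} _ = All.[] ∷ []
subsets-unique {x ∷ xs} (x∉xs ∷ xs!) =
  Unique.++⁺ (Unique.map⁺ ∷-injectiveʳ (subsets-unique xs!)) (subsets-unique xs!) disjoint
  where
  disjoint : ∀ {Y} → ¬ (Y ∈ map (x ∷_) (subsets xs) × Y ∈ subsets xs)
  disjoint (Y∈₁ , Y∈₂) with ∈-map⁻ (x ∷_) Y∈₁
  ... | _ , _ , refl = All¬⇒¬Any x∉xs (subsets-⊆ xs Y∈₂ (here refl))

filterᵇ∈subsets : ∀ (v : ℕ → Bool) V → filterᵇ v V ∈ subsets V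
filterᵇ∈subsets v [] = here refl
filterᵇ∈subsets v (x ∷ xs) with v x
... | true  = ∈-++⁺ˡ (∈-map⁺ (x ∷_) (filterᵇ∈subsets v xs))
... | false = ∈-++⁺ʳ (map (x ∷_) (subsets xs)) (filterᵇ∈subsets v xs)

∈⇔worldVal : ∀ {p X} → p ∈ X ⇔ T (worldVal X p)
∈⇔worldVal {p} =
  mk⇔ (any⁺ _ ∘ Any.map (≡⇒≡ᵇ p _)) (Any.map (≡ᵇ⇒≡ p _) ∘ any⁻ _ _)

worldVal-filterᵇ : ∀ (v : ℕ → Bool) {V p} → p ∈ V → worldVal (filterᵇ v V) p ≡ v p
worldVal-filterᵇ v {V} p∈V = ⇔→≡ (mk⇔
  (to T-≡ ∘ proj₂ ∘ ∈-filter⁻ (T? ∘ v) {xs = V} ∘ from ∈⇔worldVal ∘ from T-≡)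
  (to T-≡ ∘ to ∈⇔worldVal ∘ ∈-filter⁺ (T? ∘ v) p∈V ∘ from T-≡))

eval-cong : ∀ {v w} φ → (∀ {p} → p ∈ vars φ → v p ≡ w p) → eval v φ ≡ eval w φ
eval-cong (var p)  v≗w = v≗w (here refl)
eval-cong (¬ᶠ φ)   v≗w = cong not (eval-cong φ v≗w)
eval-cong (φ ∧ᶠ ψ) v≗w =
  cong₂ _∧_ (eval-cong φ (v≗w ∘ ∈-++⁺ˡ)) (eval-cong ψ (v≗w ∘ ∈-++⁺ʳ (vars φ)))
eval-cong (φ ∨ᶠ ψ) v≗w =
  cong₂ _∨_ (eval-cong φ (v≗w ∘ ∈-++⁺ˡ)) (eval-cong ψ (v≗w ∘ ∈-++⁺ʳ (vars φ)))

evalLits-cong : ∀ {v w} ls → (∀ {l} → l ∈ ls → v (litVar l) ≡ w (litVar l)) →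
  evalLits v ls ≡ evalLits w ls
evalLits-cong []          _   = refl
evalLits-cong (pos p ∷ ls) v≗w = cong₂ _∧_ (v≗w (here refl)) (evalLits-cong ls (v≗w ∘ there))
evalLits-cong (neg p ∷ ls) v≗w =
  cong₂ _∧_ (cong not (v≗w (here refl))) (evalLits-cong ls (v≗w ∘ there))

eval-filterᵇ : ∀ (v : ℕ → Bool) {V} φ → vars φ ⊆ V →
  eval (worldVal (filterᵇ v V)) φ ≡ eval v φ
eval-filterᵇ v φ φ⊆V = eval-cong φ (worldVal-filterᵇ v ∘ φ⊆V)

evalLits-filterᵇ : ∀ (v : ℕ → Bool) {V} ls → (∀ {l} → l ∈ ls → litVar l ∈ V) →
  evalLits (worldVal (filterᵇ v V)) ls ≡ evalLits v ls
evalLits-filterᵇ v ls ls⊆V = evalLits-cong ls (worldVal-filterᵇ v ∘ ls⊆V)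

module _ {V : List ℕ} (M : ProbModel V) where

  μ-mono : ∀ {A B} → (∀ X → T (A X) → T (B X)) → μ M A ≤ μ M B
  μ-mono A⇒B = sumℚ-filterᵇ-mono (mass M) _ _ (subsets V) (nonneg M) A⇒B

  condPr-≡1 : ∀ {a b} (μb>0 : 0ℚ < μ M b) → (∀ X → T (b X) → T (a X)) →
    condPr M a b μb>0 ≡ 1ℚ
  condPr-≡1 {a} {b} μb>0 b⇒a = begin
    μ M (λ X → a X ∧ b X) * 1/ μ M b  ≡⟨ cong (_* 1/ μ M b) μ[a∧b]≡μb ⟩
    μ M b * 1/ μ M b                  ≡⟨ *-inverseʳ (μ M b) ⟩
    1ℚ                                ∎
    where
    open ≡-Reasoning
    instance
      μb≢0 : NonZero (μ M b)
      μb≢0 = pos⇒nonZero (μ M b) {{positive μb>0}}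
    μ[a∧b]≡μb : μ M (λ X → a X ∧ b X) ≡ μ M b
    μ[a∧b]≡μb = ≤-antisym (μ-mono (λ _ → proj₂ ∘ to T-∧))
                          (μ-mono (λ X bX → from T-∧ (b⇒a X bX , bX)))

_≟ᵂ_ : DecidableEquality (List ℕ)
_≟ᵂ_ = ≡-dec ℕ._≟_

dirac : ∀ {V} → Unique V → ∀ {X} → X ∈ subsets V → ProbModel V
dirac V! {X} X∈ = record
  { mass   = pointMass _≟ᵂ_ X
  ; nonneg = λ Y _ → pointMass-nonNeg _≟ᵂ_ X Y
  ; total  = sumℚ-pointMass-∈ _≟ᵂ_ (subsets-unique V!) X∈
  }

module _ {V : List ℕ} (V! : Unique V) {X} (X∈ : X ∈ subsets V) where

  μ-dirac-accept : ∀ A → T (A X) → μ (dirac V! X∈) A ≡ 1ℚ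
  μ-dirac-accept A AX = sumℚ-pointMass-∈ _≟ᵂ_
    (Unique.filter⁺ (T? ∘ A) (subsets-unique V!)) (∈-filter⁺ (T? ∘ A) X∈ AX)

  μ-dirac-reject : ∀ A → ¬ T (A X) → μ (dirac V! X∈) A ≡ 0ℚ
  μ-dirac-reject A ¬AX = sumℚ-pointMass-∉ _≟ᵂ_ _ (¬AX ∘ proj₂ ∘ ∈-filter⁻ (T? ∘ A) {xs = subsets V})

  μ-dirac-mono⁻ : ∀ A B → μ (dirac V! X∈) A ≤ μ (dirac V! X∈) B → T (A X) → T (B X)
  μ-dirac-mono⁻ A B μA≤μB AX with T? (B X)
  ... | yes BX = BX
  ... | no ¬BX = ⊥-elim (1≰0 (subst₂ _≤_ (μ-dirac-accept A AX) (μ-dirac-reject B ¬BX) μA≤μB))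

module _ (P : PrAP) where

  ∈Vars : ∀ {p} → p ∈ vars (φ P) ++ vars (χ P) → p ∈ Vars P
  ∈Vars = ∈-deduplicate⁺ ℕ._≟_

  μ-≤⇒Entails : ∀ τ → BuiltFromH P τ →
    (∀ (M : ProbModel (Vars P)) → μ M ⟦ φ P ∧ τ ⟧ᵗ ≤ μ M ⟦ χ P ⟧) →
    Entails (φ P) τ (χ P)
  μ-≤⇒Entails τ τ⊆H μ-≤ v φτ =
    subst T ⟦χ⟧X≡ (μ-dirac-mono⁻ V! X∈ _ _ (μ-≤ (dirac V! X∈)) (subst T (sym ⟦φ∧τ⟧X≡) φτ))
    where
    V! = deduplicate-! (vars (φ P) ++ vars (χ P))
    X∈ = filterᵇ∈subsets v (Vars P)
    τ⊆Vars : ∀ {l} → l ∈ toList τ → litVar l ∈ Vars P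
    τ⊆Vars = ∈Vars ∘ All.lookup (H-vars P) ∘ ∈-map⁺ litVar ∘ All.lookup τ⊆H
    ⟦φ∧τ⟧X≡ : ⟦ φ P ∧ τ ⟧ᵗ (filterᵇ v (Vars P)) ≡ eval v (φ P) ∧ evalTerm v τ
    ⟦φ∧τ⟧X≡ = cong₂ _∧_ (eval-filterᵇ v (φ P) (∈Vars ∘ ∈-++⁺ˡ))
                        (evalLits-filterᵇ v (toList τ) τ⊆Vars)
    ⟦χ⟧X≡ : ⟦ χ P ⟧ (filterᵇ v (Vars P)) ≡ eval v (χ P)
    ⟦χ⟧X≡ = eval-filterᵇ v (χ P) (∈Vars ∘ ∈-++⁺ʳ (vars (φ P)))

proposition5 : (P : PrAP) (τ : Term) → BuiltFromH P τ →
    IsSolution P τ ⇔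
      ((∀ (M : ProbModel (Vars P)) → μ M ⟦ φ P ∧ τ ⟧ᵗ ≤ μ M ⟦ χ P ⟧) ×
       (∃[ M′ ] (Coherent P M′ × CondPrIs M′ ⟦ χ P ⟧ ⟦ φ P ∧ τ ⟧ᵗ 1ℚ)))
proposition5 P τ τ⊆H = mk⇔
  (λ (_ , entails , M , coherent , μ>0) →
     let ⊆χ = λ X → entails (worldVal X)
     in (λ M → μ-mono M ⊆χ) , M , coherent , μ>0 , condPr-≡1 M μ>0 ⊆χ)
  (λ (μ-≤ , M , coherent , μ>0 , _) →
     τ⊆H , μ-≤⇒Entails P τ τ⊆H μ-≤ , M , coherent , μ>0)
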